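{- Let $k$ be a field of characteristic $p>2$ and $g\geq 1$. The polynomial $\mathrm{Det}_g(\lambda_1,\dots,\lambda_{2g+1})$ has degree exactly $d = g(p-1)/2$ in the variable $\lambda_{2g+1}$.
   Context: Let $c_r\in k[\lambda_1,\dots,\lambda_{2g+1}]$ be the coefficient of $x^r$ in $\left(\prod_{i=1}^{2g+1}(x-\lambda_i)\right)^{(p-1)/2}$ (with $c_r=0$ for $r<0$), $A_g$ the $g\times g$ matrix with $(i,j)$ entry $c_{ip-j}$, and $\mathrm{Det}_g = \det A_g$. -}

module Defs where

open import Level using (Level; _⊔_)
open import Data.Nat as ℕ using (ℕ; zero; suc; _∸_; _<_; _<ᵇ_)
open import Data.Nat.Primality using (Prime)
open import Data.Bool using (if_then_else_)
open import Data.Fin using (Fin; zero; suc; toℕ; opposite; punchIn)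
open import Data.List using (List; []; _∷_; map)
open import Data.Product using (Σ; _×_)
open import Relation.Nullary using (¬_)
open import Algebra.Bundles using (CommutativeRing)
open import Algebra.Bundles.Raw using (RawRing)

IsField : ∀ {c ℓ} → CommutativeRing c ℓ → Set (c ⊔ ℓ)
IsField K = (¬ (1# ≈ 0#)) × (∀ x → ¬ (x ≈ 0#) → Σ Carrier λ y → x * y ≈ 1#)
  where open CommutativeRing K

_·1 : ∀ {c ℓ} {K : CommutativeRing c ℓ} → ℕ → CommutativeRing.Carrier K
_·1 {K = K} zero    = CommutativeRing.0# K
_·1 {K = K} (suc n) = CommutativeRing._+_ K (CommutativeRing.1# K) (_·1 {K = K} n)

HasCharacteristic : ∀ {c ℓ} → CommutativeRing c ℓ → ℕ → Set ℓ
HasCharacteristic K p = Prime p × CommutativeRing._≈_ K (_·1 {K = K} p) (CommutativeRing.0# K)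

-- Univariate polynomials over a raw ring A, as dense coefficient lists
-- (constant term first). Equality = equality of all coefficients.

module _ {c ℓ} (A : RawRing c ℓ) where
  open RawRing A

  coeff : ℕ → List Carrier → Carrier
  coeff _       []       = 0#
  coeff zero    (x ∷ xs) = x
  coeff (suc i) (x ∷ xs) = coeff i xs

  addL : List Carrier → List Carrier → List Carrier
  addL []       ys       = ys
  addL (x ∷ xs) []       = x ∷ xs
  addL (x ∷ xs) (y ∷ ys) = (x + y) ∷ addL xs ys

  mulL : List Carrier → List Carrier → List Carrier
  mulL []       ys = []
  mulL (x ∷ xs) ys = addL (map (x *_) ys) (0# ∷ mulL xs ys)

  PolyRing : RawRing c ℓ
  PolyRing = record
    { Carrier = List Carrier
    ; _≈_     = λ xs ys → ∀ i → coeff i xs ≈ coeff i ys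
    ; _+_     = addL
    ; _*_     = mulL
    ; -_      = map -_
    ; 0#      = []
    ; 1#      = 1# ∷ []
    }

-- Polynomials in n variables: MPoly A 0 = A, MPoly A (suc n) = (MPoly A n)[X].
-- Variable 'zero' of MPoly A (suc n) is the outermost variable X.
MPoly : ∀ {c ℓ} → RawRing c ℓ → ℕ → RawRing c ℓ
MPoly A zero    = A
MPoly A (suc n) = PolyRing (MPoly A n)

var : ∀ {c ℓ} (A : RawRing c ℓ) (n : ℕ) → Fin n → RawRing.Carrier (MPoly A n)
var A (suc n) zero    = RawRing.0# (MPoly A n) ∷ RawRing.1# (MPoly A n) ∷ []
var A (suc n) (suc i) = var A n i ∷ []

module _ {c ℓ} (A : RawRing c ℓ) where
  open RawRing A

  pow : Carrier → ℕ → Carrier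
  pow x zero    = 1#
  pow x (suc n) = x * pow x n

  sumFin : ∀ n → (Fin n → Carrier) → Carrier
  sumFin zero    f = 0#
  sumFin (suc n) f = f zero + sumFin n (λ i → f (suc i))

  prodFin : ∀ n → (Fin n → Carrier) → Carrier
  prodFin zero    f = 1#
  prodFin (suc n) f = f zero * prodFin n (λ i → f (suc i))

  sign : ℕ → Carrier → Carrier
  sign zero          x = x
  sign (suc zero)    x = - x
  sign (suc (suc n)) x = sign n x

  det : ∀ n → (Fin n → Fin n → Carrier) → Carrier
  det zero    M = 1#
  det (suc n) M = sumFin (suc n) λ j →
    sign (toℕ j) (M zero j * det n (λ r s → M (suc r) (punchIn j s)))

module Hasse {a ℓ} (K : CommutativeRing a ℓ) (p g : ℕ) where
  open CommutativeRing K using (rawRing)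

  -- k[λ_1, …, λ_{2g+1}]; λ_{2g+1} is the outermost variable.
  Λ : RawRing a ℓ
  Λ = MPoly rawRing (suc (2 ℕ.* g))

  -- λ_{i+1} for i : Fin (2g+1)  (λ_{2g+1} = var zero)
  lam : Fin (suc (2 ℕ.* g)) → RawRing.Carrier Λ
  lam i = var rawRing (suc (2 ℕ.* g)) (opposite i)

  Λx : RawRing a ℓ
  Λx = PolyRing Λ

  f : RawRing.Carrier Λx
  f = prodFin Λx (suc (2 ℕ.* g)) λ i → RawRing.-_ Λ (lam i) ∷ RawRing.1# Λ ∷ []

  c : ℕ → RawRing.Carrier Λ
  c r = coeff Λ r (pow Λx f ((p ∸ 1) ℕ./ 2))

  -- (i,j) entry c_{ip-j}, with i,j ∈ {1..g}; c_r = 0 for r < 0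
  A : Fin g → Fin g → RawRing.Carrier Λ
  A i j = if (suc (toℕ i) ℕ.* p) <ᵇ suc (toℕ j)
            then RawRing.0# Λ
            else c (suc (toℕ i) ℕ.* p ∸ suc (toℕ j))

  Det : RawRing.Carrier Λ
  Det = det Λ g A

  -- "Det has degree exactly d in λ_{2g+1}": viewing Det ∈ k[λ_1..λ_2g][λ_{2g+1}],
  -- the coefficient of λ_{2g+1}^d is nonzero and all higher ones vanish.
  Inner : RawRing a ℓ
  Inner = MPoly rawRing (2 ℕ.* g)

  DegreeInLastIs : ℕ → Set ℓ
  DegreeInLastIs d =
    (¬ RawRing._≈_ Inner (coeff Inner d Det) (RawRing.0# Inner)) ×
    (∀ m → d < m → RawRing._≈_ Inner (coeff Inner m Det) (RawRing.0# Inner))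

-- Write D(m, g) for the g × g determinant built from ∏ᵢ₌₁ᵐ (x − λᵢ), so that Det_g = D(2g+1, g).
-- The factor x − λₘ₊₁ has leading coefficient −1 in λₘ₊₁, so each c_r of D(m+1, g) has
-- λₘ₊₁-degree ≤ n = (p−1)/2 and λₘ₊₁ⁿ-coefficient (−1)ⁿ times the c_r of D(m, g); expanding the
-- determinant, D(m+1, g) has λₘ₊₁-degree ≤ gn with λₘ₊₁^(gn)-coefficient ±D(m, g). So the degree
-- is exactly gn as soon as D(m, g) ≠ 0, and D(2g+1, g) ≠ 0 follows by induction on g: for
-- m = 2g+2, fⁿ is monic of degree n(2g+2) = (g+1)p − (g+1), so the last row of D(2g+2, g+1) is
-- (0, …, 0, 1), whence D(2g+1, g) ≠ 0 ⇒ D(2g+2, g) = D(2g+2, g+1) ≠ 0 ⇒ D(2g+3, g+1) ≠ 0.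

module Submission where

open import Defs
open import Level using (_⊔_)
open import Data.Nat as ℕ using (ℕ; zero; suc; _<_; _≤_; s≤s; z≤n)
import Data.Nat.Properties as ℕ
import Data.Nat.DivMod as ℕ
open import Data.Fin using (Fin; zero; suc; toℕ; inject₁; fromℕ; punchIn; opposite)
open import Data.Fin.Properties using (toℕ-inject₁; toℕ-fromℕ; toℕ<n)
open import Data.List using (List; []; _∷_; map; drop)
open import Data.Bool using (true; false; if_then_else_)
open import Data.Empty using (⊥-elim)
open import Data.Product using (_×_; _,_; proj₁; proj₂)
open import Relation.Nullary using (¬_)
open import Relation.Binary.PropositionalEquality as ≡ using (_≡_)
open import Algebra.Bundles using (CommutativeRing)
open import Algebra.Bundles.Raw using (RawRing)
open import Algebra.Structures using (IsCommutativeRing)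
open import Data.Nat.Primality using (Prime; composite)
open import Data.Nat.Divisibility using (divides)
open import Data.Nat.Solver using (module +-*-Solver)
open import Relation.Binary.Bundles using (Setoid)
open import Relation.Binary.Structures using (IsEquivalence)

IsCommutativeRawRing : ∀ {c ℓ} → RawRing c ℓ → Set (c ⊔ ℓ)
IsCommutativeRawRing A = IsCommutativeRing _≈_ _+_ _*_ -_ 0# 1#
  where open RawRing A

module CommutativeRawRing {c ℓ} (A : RawRing c ℓ) (isCommRing : IsCommutativeRawRing A) where

  commutativeRing : CommutativeRing c ℓ
  commutativeRing = record { isCommutativeRing = isCommRing }

  open CommutativeRing commutativeRing public hiding (zero)
  open import Algebra.Properties.Ring ring public
    using (-0#≈0#; -‿distribˡ-*; -‿involutive; -1*x≈-x)
  open import Algebra.Properties.CommutativeSemigroup +-commutativeSemigroup public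
    using (x∙yz≈y∙xz; interchange)
  open import Algebra.Properties.CommutativeSemigroup *-commutativeSemigroup public
    using () renaming (x∙yz≈y∙xz to x*yz≈y*xz)

  open import Relation.Binary.Reasoning.Setoid setoid

  sumFin-cong : ∀ n {f g : Fin n → Carrier} → (∀ i → f i ≈ g i) → sumFin A n f ≈ sumFin A n g
  sumFin-cong zero    f≈g = refl
  sumFin-cong (suc n) f≈g = +-cong (f≈g zero) (sumFin-cong n (λ i → f≈g (suc i)))

  *-distribˡ-sumFin : ∀ n a (f : Fin n → Carrier) → a * sumFin A n f ≈ sumFin A n (λ i → a * f i)
  *-distribˡ-sumFin zero    a f = zeroʳ a
  *-distribˡ-sumFin (suc n) a f = trans (distribˡ a _ _) (+-congˡ (*-distribˡ-sumFin n a (λ i → f (suc i))))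

  sumFin-init-last : ∀ n (f : Fin (suc n) → Carrier) →
                     sumFin A (suc n) f ≈ sumFin A n (λ i → f (inject₁ i)) + f (fromℕ n)
  sumFin-init-last zero    f = trans (+-identityʳ _) (sym (+-identityˡ _))
  sumFin-init-last (suc n) f = trans (+-congˡ (sumFin-init-last n (λ i → f (suc i)))) (sym (+-assoc _ _ _))

  sign≈* : ∀ k x → sign A k x ≈ sign A k 1# * x
  sign≈* zero          x = sym (*-identityˡ x)
  sign≈* (suc zero)    x = sym (-1*x≈-x x)
  sign≈* (suc (suc k)) x = sign≈* k x

  sign-cong : ∀ k {x y} → x ≈ y → sign A k x ≈ sign A k y
  sign-cong k {x} {y} x≈y = trans (sign≈* k x) (trans (*-congˡ x≈y) (sym (sign≈* k y)))

  sign-suc : ∀ k x → sign A (suc k) x ≈ - sign A k x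
  sign-suc zero          x = refl
  sign-suc (suc zero)    x = sym (-‿involutive x)
  sign-suc (suc (suc k)) x = sign-suc k x

  *-sign : ∀ k a x → a * sign A k x ≈ sign A k (a * x)
  *-sign k a x = trans (*-congˡ (sign≈* k x)) (trans (x*yz≈y*xz a _ x) (sym (sign≈* k (a * x))))

  sign-comm : ∀ j k x → sign A j (sign A k x) ≈ sign A k (sign A j x)
  sign-comm j k x = begin
    sign A j (sign A k x)             ≈⟨ sign≈* j _ ⟩
    sign A j 1# * sign A k x          ≈⟨ *-sign k _ x ⟩
    sign A k (sign A j 1# * x)        ≈⟨ sign-cong k (sign≈* j x) ⟨
    sign A k (sign A j x)             ∎

  sign-0# : ∀ k → sign A k 0# ≈ 0#
  sign-0# k = trans (sign≈* k 0#) (zeroʳ _)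

  sign≈0⇒≈0 : ∀ k {x} → sign A k x ≈ 0# → x ≈ 0#
  sign≈0⇒≈0 zero          x≈0  = x≈0
  sign≈0⇒≈0 (suc zero)    {x} -x≈0 = begin
    x         ≈⟨ -‿involutive x ⟨
    - (- x)   ≈⟨ -‿cong -x≈0 ⟩
    - 0#      ≈⟨ -0#≈0# ⟩
    0#        ∎
  sign≈0⇒≈0 (suc (suc k)) sx≈0 = sign≈0⇒≈0 k sx≈0

  sum-sign : ∀ n k (f : Fin n → Carrier) → sumFin A n (λ i → sign A k (f i)) ≈ sign A k (sumFin A n f)
  sum-sign n k f = begin
    sumFin A n (λ i → sign A k (f i))        ≈⟨ sumFin-cong n (λ i → sign≈* k (f i)) ⟩
    sumFin A n (λ i → sign A k 1# * f i)     ≈⟨ *-distribˡ-sumFin n (sign A k 1#) f ⟨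
    sign A k 1# * sumFin A n f               ≈⟨ sign≈* k _ ⟨
    sign A k (sumFin A n f)                  ∎

  pow-neg : ∀ n x → pow A (- x) n ≈ sign A n (pow A x n)
  pow-neg zero    x = refl
  pow-neg (suc n) x = begin
    - x * pow A (- x) n              ≈⟨ *-congˡ (pow-neg n x) ⟩
    - x * sign A n (pow A x n)       ≈⟨ -‿distribˡ-* x _ ⟨
    - (x * sign A n (pow A x n))     ≈⟨ -‿cong (*-sign n x _) ⟩
    - sign A n (x * pow A x n)       ≈⟨ sign-suc n _ ⟨
    sign A (suc n) (x * pow A x n)   ∎

  pow-1# : ∀ n → pow A 1# n ≈ 1#
  pow-1# zero    = refl
  pow-1# (suc n) = trans (*-identityˡ _) (pow-1# n)

  prodFin-1# : ∀ n → prodFin A n (λ _ → 1#) ≈ 1#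
  prodFin-1# zero    = refl
  prodFin-1# (suc n) = trans (*-identityˡ _) (prodFin-1# n)

module Polynomials {c ℓ} (A : RawRing c ℓ) (isCommRing : IsCommutativeRawRing A) where

  open CommutativeRawRing A isCommRing
  open RawRing (PolyRing A) public using ()
    renaming (_≈_ to _≋_; _+_ to _+ₚ_; _*_ to _*ₚ_; -_ to -ₚ_; 0# to 0ₚ; 1# to 1ₚ)
  open import Relation.Binary.Reasoning.Setoid setoid
  import Algebra.Consequences.Setoid as Consequences

  coeff-+ : ∀ i xs ys → coeff A i (xs +ₚ ys) ≈ coeff A i xs + coeff A i ys
  coeff-+ i       []       ys       = sym (+-identityˡ _)
  coeff-+ i       (x ∷ xs) []       = sym (+-identityʳ _)
  coeff-+ zero    (x ∷ xs) (y ∷ ys) = refl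
  coeff-+ (suc i) (x ∷ xs) (y ∷ ys) = coeff-+ i xs ys

  coeff-neg : ∀ i xs → coeff A i (-ₚ xs) ≈ - coeff A i xs
  coeff-neg i       []       = sym -0#≈0#
  coeff-neg zero    (x ∷ xs) = refl
  coeff-neg (suc i) (x ∷ xs) = coeff-neg i xs

  coeff-scale : ∀ a i xs → coeff A i (map (a *_) xs) ≈ a * coeff A i xs
  coeff-scale a i       []       = sym (zeroʳ a)
  coeff-scale a zero    (x ∷ xs) = refl
  coeff-scale a (suc i) (x ∷ xs) = coeff-scale a i xs

  coeff-∷-* : ∀ i x xs ys → coeff A i ((x ∷ xs) *ₚ ys) ≈ x * coeff A i ys + coeff A i (0# ∷ xs *ₚ ys)
  coeff-∷-* i x xs ys = trans (coeff-+ i (map (x *_) ys) (0# ∷ xs *ₚ ys)) (+-congʳ (coeff-scale x i ys))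

  ≋-sym : ∀ xs ys → xs ≋ ys → ys ≋ xs
  ≋-sym xs ys xs≋ys i = sym (xs≋ys i)

  ≋-trans : ∀ xs ys zs → xs ≋ ys → ys ≋ zs → xs ≋ zs
  ≋-trans xs ys zs xs≋ys ys≋zs i = trans (xs≋ys i) (ys≋zs i)

  ∷-cong : ∀ {x y} xs ys → x ≈ y → xs ≋ ys → (x ∷ xs) ≋ (y ∷ ys)
  ∷-cong xs ys x≈y xs≋ys zero    = x≈y
  ∷-cong xs ys x≈y xs≋ys (suc i) = xs≋ys i

  0∷-zero : ∀ xs → xs ≋ 0ₚ → (0# ∷ xs) ≋ 0ₚ
  0∷-zero xs xs≈0 zero    = refl
  0∷-zero xs xs≈0 (suc i) = xs≈0 i

  coeff-0∷[] : ∀ i → coeff A i (0# ∷ []) ≈ 0#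
  coeff-0∷[] = 0∷-zero [] (λ _ → refl)

  coeff-0∷-+ : ∀ i xs ys → coeff A i (0# ∷ xs +ₚ ys) ≈ coeff A i (0# ∷ xs) + coeff A i (0# ∷ ys)
  coeff-0∷-+ zero    xs ys = sym (+-identityˡ 0#)
  coeff-0∷-+ (suc i) xs ys = coeff-+ i xs ys

  0∷-* : ∀ xs ys → (0# ∷ xs) *ₚ ys ≋ (0# ∷ xs *ₚ ys)
  0∷-* xs ys i = trans (coeff-∷-* i 0# xs ys) (trans (+-congʳ (zeroˡ _)) (+-identityˡ _))

  +ₚ-cong : ∀ xs xs′ ys ys′ → xs ≋ xs′ → ys ≋ ys′ → xs +ₚ ys ≋ xs′ +ₚ ys′
  +ₚ-cong xs xs′ ys ys′ xs≋ ys≋ i =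
    trans (coeff-+ i xs ys) (trans (+-cong (xs≋ i) (ys≋ i)) (sym (coeff-+ i xs′ ys′)))

  -ₚ-cong : ∀ xs ys → xs ≋ ys → -ₚ xs ≋ -ₚ ys
  -ₚ-cong xs ys xs≋ys i = trans (coeff-neg i xs) (trans (-‿cong (xs≋ys i)) (sym (coeff-neg i ys)))

  *ₚ-zeroˡ : ∀ xs ys → xs ≋ 0ₚ → xs *ₚ ys ≋ 0ₚ
  *ₚ-zeroˡ []       ys xs≈0 i = refl
  *ₚ-zeroˡ (x ∷ xs) ys xs≈0 i = begin
    coeff A i ((x ∷ xs) *ₚ ys)                   ≈⟨ coeff-∷-* i x xs ys ⟩
    x * coeff A i ys + coeff A i (0# ∷ xs *ₚ ys) ≈⟨ +-cong (trans (*-congʳ (xs≈0 0)) (zeroˡ _))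
                                                     (0∷-zero (xs *ₚ ys) (*ₚ-zeroˡ xs ys (λ j → xs≈0 (suc j))) i) ⟩
    0# + 0#                                      ≈⟨ +-identityˡ 0# ⟩
    0#                                           ∎

  *ₚ-congʳ : ∀ xs xs′ ys → xs ≋ xs′ → xs *ₚ ys ≋ xs′ *ₚ ys
  *ₚ-congʳ []       xs′        ys xs≋ = ≋-sym (xs′ *ₚ ys) [] (*ₚ-zeroˡ xs′ ys (≋-sym [] xs′ xs≋))
  *ₚ-congʳ (x ∷ xs) []         ys xs≋ = *ₚ-zeroˡ (x ∷ xs) ys xs≋
  *ₚ-congʳ (x ∷ xs) (x′ ∷ xs′) ys xs≋ i = begin
    coeff A i ((x ∷ xs) *ₚ ys)                     ≈⟨ coeff-∷-* i x xs ys ⟩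
    x * coeff A i ys + coeff A i (0# ∷ xs *ₚ ys)   ≈⟨ +-cong (*-congʳ (xs≋ 0)) (∷-cong (xs *ₚ ys) (xs′ *ₚ ys) refl
                                                        (*ₚ-congʳ xs xs′ ys (λ j → xs≋ (suc j))) i) ⟩
    x′ * coeff A i ys + coeff A i (0# ∷ xs′ *ₚ ys) ≈⟨ coeff-∷-* i x′ xs′ ys ⟨
    coeff A i ((x′ ∷ xs′) *ₚ ys)                   ∎

  *ₚ-congˡ : ∀ xs ys ys′ → ys ≋ ys′ → xs *ₚ ys ≋ xs *ₚ ys′
  *ₚ-congˡ []       ys ys′ ys≋ i = refl
  *ₚ-congˡ (x ∷ xs) ys ys′ ys≋ i = begin
    coeff A i ((x ∷ xs) *ₚ ys)                     ≈⟨ coeff-∷-* i x xs ys ⟩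
    x * coeff A i ys + coeff A i (0# ∷ xs *ₚ ys)   ≈⟨ +-cong (*-congˡ (ys≋ i)) (∷-cong (xs *ₚ ys) (xs *ₚ ys′) refl
                                                        (*ₚ-congˡ xs ys ys′ ys≋) i) ⟩
    x * coeff A i ys′ + coeff A i (0# ∷ xs *ₚ ys′) ≈⟨ coeff-∷-* i x xs ys′ ⟨
    coeff A i ((x ∷ xs) *ₚ ys′)                    ∎

  *ₚ-cong : ∀ xs xs′ ys ys′ → xs ≋ xs′ → ys ≋ ys′ → xs *ₚ ys ≋ xs′ *ₚ ys′
  *ₚ-cong xs xs′ ys ys′ xs≋ ys≋ i = trans (*ₚ-congʳ xs xs′ ys xs≋ i) (*ₚ-congˡ xs′ ys ys′ ys≋ i)

  *ₚ-zeroʳ : ∀ xs → xs *ₚ 0ₚ ≋ 0ₚ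
  *ₚ-zeroʳ []       i = refl
  *ₚ-zeroʳ (x ∷ xs) i = begin
    coeff A i ((x ∷ xs) *ₚ [])               ≈⟨ coeff-∷-* i x xs [] ⟩
    x * 0# + coeff A i (0# ∷ xs *ₚ [])       ≈⟨ +-cong (zeroʳ x) (0∷-zero (xs *ₚ []) (*ₚ-zeroʳ xs) i) ⟩
    0# + 0#                                  ≈⟨ +-identityˡ 0# ⟩
    0#                                       ∎

  *ₚ-∷ʳ : ∀ xs y ys → xs *ₚ (y ∷ ys) ≋ map (y *_) xs +ₚ (0# ∷ xs *ₚ ys)
  *ₚ-∷ʳ []       y ys i       = sym (coeff-0∷[] i)
  *ₚ-∷ʳ (x ∷ xs) y ys zero    = +-congʳ (*-comm x y)
  *ₚ-∷ʳ (x ∷ xs) y ys (suc i) = begin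
    coeff A i (map (x *_) ys +ₚ xs *ₚ (y ∷ ys))
      ≈⟨ coeff-+ i (map (x *_) ys) (xs *ₚ (y ∷ ys)) ⟩
    coeff A i (map (x *_) ys) + coeff A i (xs *ₚ (y ∷ ys))
      ≈⟨ +-cong (coeff-scale x i ys) (trans (*ₚ-∷ʳ xs y ys i) (coeff-+ i (map (y *_) xs) (0# ∷ xs *ₚ ys))) ⟩
    x * coeff A i ys + (coeff A i (map (y *_) xs) + coeff A i (0# ∷ xs *ₚ ys))
      ≈⟨ x∙yz≈y∙xz _ _ _ ⟩
    coeff A i (map (y *_) xs) + (x * coeff A i ys + coeff A i (0# ∷ xs *ₚ ys))
      ≈⟨ +-congˡ (coeff-∷-* i x xs ys) ⟨
    coeff A i (map (y *_) xs) + coeff A i ((x ∷ xs) *ₚ ys)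
      ≈⟨ coeff-+ i (map (y *_) xs) ((x ∷ xs) *ₚ ys) ⟨
    coeff A i (map (y *_) xs +ₚ (x ∷ xs) *ₚ ys)
      ∎

  *ₚ-comm : ∀ xs ys → xs *ₚ ys ≋ ys *ₚ xs
  *ₚ-comm []       ys i = sym (*ₚ-zeroʳ ys i)
  *ₚ-comm (x ∷ xs) ys i =
    trans (+ₚ-cong (map (x *_) ys) (map (x *_) ys) (0# ∷ xs *ₚ ys) (0# ∷ ys *ₚ xs)
             (λ _ → refl) (∷-cong (xs *ₚ ys) (ys *ₚ xs) refl (*ₚ-comm xs ys)) i)
          (sym (*ₚ-∷ʳ ys x xs i))

  *ₚ-distribʳ : ∀ zs xs ys → (xs +ₚ ys) *ₚ zs ≋ xs *ₚ zs +ₚ ys *ₚ zs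
  *ₚ-distribʳ zs []       ys       i = refl
  *ₚ-distribʳ zs (x ∷ xs) []       i = sym (trans (coeff-+ i ((x ∷ xs) *ₚ zs) []) (+-identityʳ _))
  *ₚ-distribʳ zs (x ∷ xs) (y ∷ ys) i = begin
    coeff A i (((x + y) ∷ xs +ₚ ys) *ₚ zs)
      ≈⟨ coeff-∷-* i (x + y) (xs +ₚ ys) zs ⟩
    (x + y) * coeff A i zs + coeff A i (0# ∷ (xs +ₚ ys) *ₚ zs)
      ≈⟨ +-cong (distribʳ _ x y)
           (trans (∷-cong ((xs +ₚ ys) *ₚ zs) (xs *ₚ zs +ₚ ys *ₚ zs) refl (*ₚ-distribʳ zs xs ys) i)
                  (coeff-0∷-+ i (xs *ₚ zs) (ys *ₚ zs))) ⟩
    (x * coeff A i zs + y * coeff A i zs) + (coeff A i (0# ∷ xs *ₚ zs) + coeff A i (0# ∷ ys *ₚ zs))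
      ≈⟨ interchange _ _ _ _ ⟩
    (x * coeff A i zs + coeff A i (0# ∷ xs *ₚ zs)) + (y * coeff A i zs + coeff A i (0# ∷ ys *ₚ zs))
      ≈⟨ +-cong (coeff-∷-* i x xs zs) (coeff-∷-* i y ys zs) ⟨
    coeff A i ((x ∷ xs) *ₚ zs) + coeff A i ((y ∷ ys) *ₚ zs)
      ≈⟨ coeff-+ i ((x ∷ xs) *ₚ zs) ((y ∷ ys) *ₚ zs) ⟨
    coeff A i ((x ∷ xs) *ₚ zs +ₚ (y ∷ ys) *ₚ zs)
      ∎

  scale-*ₚ : ∀ a xs ys → map (a *_) xs *ₚ ys ≋ map (a *_) (xs *ₚ ys)
  scale-*ₚ a []       ys i = refl
  scale-*ₚ a (x ∷ xs) ys i = begin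
    coeff A i (((a * x) ∷ map (a *_) xs) *ₚ ys)                   ≈⟨ coeff-∷-* i (a * x) (map (a *_) xs) ys ⟩
    (a * x) * coeff A i ys + coeff A i (0# ∷ map (a *_) xs *ₚ ys)  ≈⟨ +-cong (*-assoc a x _) (shifted i) ⟩
    a * (x * coeff A i ys) + a * coeff A i (0# ∷ xs *ₚ ys)         ≈⟨ distribˡ a _ _ ⟨
    a * (x * coeff A i ys + coeff A i (0# ∷ xs *ₚ ys))             ≈⟨ *-congˡ (coeff-∷-* i x xs ys) ⟨
    a * coeff A i ((x ∷ xs) *ₚ ys)                                 ≈⟨ coeff-scale a i ((x ∷ xs) *ₚ ys) ⟨
    coeff A i (map (a *_) ((x ∷ xs) *ₚ ys))                        ∎
    where
    shifted : ∀ i → coeff A i (0# ∷ map (a *_) xs *ₚ ys) ≈ a * coeff A i (0# ∷ xs *ₚ ys)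
    shifted zero    = sym (zeroʳ a)
    shifted (suc i) = trans (scale-*ₚ a xs ys i) (coeff-scale a i (xs *ₚ ys))

  *ₚ-assoc : ∀ xs ys zs → (xs *ₚ ys) *ₚ zs ≋ xs *ₚ (ys *ₚ zs)
  *ₚ-assoc []       ys zs i = refl
  *ₚ-assoc (x ∷ xs) ys zs i = trans (*ₚ-distribʳ zs (map (x *_) ys) (0# ∷ xs *ₚ ys) i)
    (+ₚ-cong (map (x *_) ys *ₚ zs) (map (x *_) (ys *ₚ zs)) ((0# ∷ xs *ₚ ys) *ₚ zs) (0# ∷ xs *ₚ (ys *ₚ zs))
      (scale-*ₚ x ys zs)
      (λ j → trans (0∷-* (xs *ₚ ys) zs j)
                   (∷-cong ((xs *ₚ ys) *ₚ zs) (xs *ₚ (ys *ₚ zs)) refl (*ₚ-assoc xs ys zs) j)) i)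

  *ₚ-identityˡ : ∀ xs → 1ₚ *ₚ xs ≋ xs
  *ₚ-identityˡ xs i = trans (coeff-∷-* i 1# [] xs) (trans (+-cong (*-identityˡ _) (coeff-0∷[] i)) (+-identityʳ _))

  +ₚ-assoc : ∀ xs ys zs → (xs +ₚ ys) +ₚ zs ≋ xs +ₚ (ys +ₚ zs)
  +ₚ-assoc xs ys zs i = begin
    coeff A i ((xs +ₚ ys) +ₚ zs)                  ≈⟨ coeff-+ i (xs +ₚ ys) zs ⟩
    coeff A i (xs +ₚ ys) + coeff A i zs           ≈⟨ +-congʳ (coeff-+ i xs ys) ⟩
    (coeff A i xs + coeff A i ys) + coeff A i zs  ≈⟨ +-assoc _ _ _ ⟩
    coeff A i xs + (coeff A i ys + coeff A i zs)  ≈⟨ +-congˡ (coeff-+ i ys zs) ⟨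
    coeff A i xs + coeff A i (ys +ₚ zs)           ≈⟨ coeff-+ i xs (ys +ₚ zs) ⟨
    coeff A i (xs +ₚ (ys +ₚ zs))                  ∎

  +ₚ-comm : ∀ xs ys → xs +ₚ ys ≋ ys +ₚ xs
  +ₚ-comm xs ys i = trans (coeff-+ i xs ys) (trans (+-comm _ _) (sym (coeff-+ i ys xs)))

  +ₚ-identityʳ : ∀ xs → xs +ₚ 0ₚ ≋ xs
  +ₚ-identityʳ xs i = trans (coeff-+ i xs []) (+-identityʳ _)

  -ₚ-inverseˡ : ∀ xs → -ₚ xs +ₚ xs ≋ 0ₚ
  -ₚ-inverseˡ xs i = trans (coeff-+ i (-ₚ xs) xs) (trans (+-congʳ (coeff-neg i xs)) (-‿inverseˡ _))

  ≋-isEquivalence : IsEquivalence _≋_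
  ≋-isEquivalence = record
    { refl  = λ i → refl
    ; sym   = λ {xs} {ys} → ≋-sym xs ys
    ; trans = λ {xs} {ys} {zs} → ≋-trans xs ys zs
    }

  ≋-setoid : Setoid c ℓ
  ≋-setoid = record { isEquivalence = ≋-isEquivalence }

  open Consequences ≋-setoid using (comm∧invˡ⇒inv; comm∧idˡ⇒id; comm∧distrʳ⇒distr)

  PolyRing-isCommutativeRing : IsCommutativeRawRing (PolyRing A)
  PolyRing-isCommutativeRing = record
    { isRing = record
      { +-isAbelianGroup = record
        { isGroup = record
          { isMonoid = record
            { isSemigroup = record
              { isMagma = record
                { isEquivalence = ≋-isEquivalence
                ; ∙-cong        = λ {xs} {xs′} {ys} {ys′} → +ₚ-cong xs xs′ ys ys′
                }
              ; assoc = +ₚ-assoc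
              }
            ; identity = (λ xs i → refl) , +ₚ-identityʳ
            }
          ; inverse = comm∧invˡ⇒inv {_∙_ = _+ₚ_} {_⁻¹ = -ₚ_} {e = 0ₚ} +ₚ-comm -ₚ-inverseˡ
          ; ⁻¹-cong = λ {xs} {ys} → -ₚ-cong xs ys
          }
        ; comm = +ₚ-comm
        }
      ; *-cong     = λ {xs} {xs′} {ys} {ys′} → *ₚ-cong xs xs′ ys ys′
      ; *-assoc    = *ₚ-assoc
      ; *-identity = comm∧idˡ⇒id {_∙_ = _*ₚ_} *ₚ-comm {e = 1ₚ} *ₚ-identityˡ
      ; distrib    = comm∧distrʳ⇒distr {_∙_ = _*ₚ_} {_◦_ = _+ₚ_}
                       (λ {xs} {xs′} {ys} {ys′} → +ₚ-cong xs xs′ ys ys′) *ₚ-comm *ₚ-distribʳ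
      }
    ; *-comm = *ₚ-comm
    }

  *ₚ-1ₚ : ∀ xs → xs *ₚ -ₚ 1ₚ ≋ -ₚ xs
  *ₚ-1ₚ xs i = trans (*ₚ-comm xs (-ₚ 1ₚ) i) (PolyRing.-1*x≈-x xs i)
    where module PolyRing = CommutativeRawRing (PolyRing A) PolyRing-isCommutativeRing

MPoly-isCommutativeRing : ∀ {c ℓ} (K : CommutativeRing c ℓ) n →
                          IsCommutativeRawRing (MPoly (CommutativeRing.rawRing K) n)
MPoly-isCommutativeRing K zero    = CommutativeRing.isCommutativeRing K
MPoly-isCommutativeRing K (suc n) =
  Polynomials.PolyRing-isCommutativeRing (MPoly (CommutativeRing.rawRing K) n) (MPoly-isCommutativeRing K n)

punchIn-fromℕ : ∀ {n} (s : Fin n) → punchIn (fromℕ n) s ≡ inject₁ s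
punchIn-fromℕ {suc n} zero    = ≡.refl
punchIn-fromℕ {suc n} (suc s) = ≡.cong suc (punchIn-fromℕ s)

punchIn-inject₁ : ∀ {n} (j : Fin (suc n)) (s : Fin n) → punchIn (inject₁ j) (inject₁ s) ≡ inject₁ (punchIn j s)
punchIn-inject₁ zero    s       = ≡.refl
punchIn-inject₁ (suc j) zero    = ≡.refl
punchIn-inject₁ (suc j) (suc s) = ≡.cong suc (punchIn-inject₁ j s)

punchIn-inject₁-fromℕ : ∀ {n} (j : Fin (suc n)) → punchIn (inject₁ j) (fromℕ n) ≡ fromℕ (suc n)
punchIn-inject₁-fromℕ zero                = ≡.refl
punchIn-inject₁-fromℕ {suc n} (suc j) = ≡.cong suc (punchIn-inject₁-fromℕ j)

module Determinants {c ℓ} (A : RawRing c ℓ) (isCommRing : IsCommutativeRawRing A) where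

  open CommutativeRawRing A isCommRing
  open import Relation.Binary.Reasoning.Setoid setoid

  Matrix : ℕ → Set c
  Matrix n = Fin n → Fin n → Carrier

  minor : ∀ {n} → Matrix (suc n) → Fin (suc n) → Matrix n
  minor M j r s = M (suc r) (punchIn j s)

  det-cong : ∀ n {M N : Matrix n} → (∀ i j → M i j ≈ N i j) → det A n M ≈ det A n N
  det-cong zero    M≈N = refl
  det-cong (suc n) M≈N = sumFin-cong (suc n) λ j →
    sign-cong (toℕ j) (*-cong (M≈N zero j) (det-cong n (λ r s → M≈N (suc r) (punchIn j s))))

  det-neg : ∀ n (M : Matrix n) → det A n (λ i j → - M i j) ≈ sign A n (det A n M)
  det-neg zero    M = refl
  det-neg (suc n) M = begin
    sumFin A (suc n) (λ j → sign A (toℕ j) (- M zero j * det A n (λ r s → - minor M j r s)))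
      ≈⟨ sumFin-cong (suc n) (λ j → sign-cong (toℕ j) (negated-term j)) ⟩
    sumFin A (suc n) (λ j → sign A (toℕ j) (sign A (suc n) (term j)))
      ≈⟨ sumFin-cong (suc n) (λ j → sign-comm (toℕ j) (suc n) (term j)) ⟩
    sumFin A (suc n) (λ j → sign A (suc n) (sign A (toℕ j) (term j)))
      ≈⟨ sum-sign (suc n) (suc n) (λ j → sign A (toℕ j) (term j)) ⟩
    sign A (suc n) (det A (suc n) M)
      ∎
    where
    term : Fin (suc n) → Carrier
    term j = M zero j * det A n (minor M j)

    negated-term : ∀ j → - M zero j * det A n (λ r s → - minor M j r s) ≈ sign A (suc n) (term j)
    negated-term j = begin
      - M zero j * det A n (λ r s → - minor M j r s)   ≈⟨ *-congˡ (det-neg n (minor M j)) ⟩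
      - M zero j * sign A n (det A n (minor M j))      ≈⟨ -‿distribˡ-* _ _ ⟨
      - (M zero j * sign A n (det A n (minor M j)))    ≈⟨ -‿cong (*-sign n _ _) ⟩
      - sign A n (term j)                              ≈⟨ sign-suc n _ ⟨
      sign A (suc n) (term j)                          ∎

  det-sign≈0⇒det≈0 : ∀ n k (M : Matrix n) → det A n (λ i j → sign A k (M i j)) ≈ 0# → det A n M ≈ 0#
  det-sign≈0⇒det≈0 n zero          M det≈0 = det≈0
  det-sign≈0⇒det≈0 n (suc zero)    M det≈0 = sign≈0⇒≈0 n (trans (sym (det-neg n M)) det≈0)
  det-sign≈0⇒det≈0 n (suc (suc k)) M det≈0 = det-sign≈0⇒det≈0 n k M det≈0

  topLeft : ∀ {n} → Matrix (suc n) → Matrix n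
  topLeft M i j = M (inject₁ i) (inject₁ j)

  det-lastRow : ∀ g (M : Matrix (suc g)) u →
                (∀ j → M (fromℕ g) (inject₁ j) ≈ 0#) → M (fromℕ g) (fromℕ g) ≈ u →
                det A (suc g) M ≈ u * det A g (topLeft M)
  det-lastRow zero    M u _     last≈u = trans (+-identityʳ _) (*-congʳ last≈u)
  det-lastRow (suc g) M u row≈0 last≈u = begin
    sumFin A (suc (suc g)) term
      ≈⟨ sumFin-init-last (suc g) term ⟩
    sumFin A (suc g) (λ j → term (inject₁ j)) + term (fromℕ (suc g))
      ≈⟨ +-cong (sumFin-cong (suc g) term-inject₁) term-last ⟩
    sumFin A (suc g) (λ j → u * topLeft-term j) + 0#
      ≈⟨ +-identityʳ _ ⟩
    sumFin A (suc g) (λ j → u * topLeft-term j)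
      ≈⟨ *-distribˡ-sumFin (suc g) u topLeft-term ⟨
    u * det A (suc g) (topLeft M)
      ∎
    where
    term : Fin (suc (suc g)) → Carrier
    term j = sign A (toℕ j) (M zero j * det A (suc g) (minor M j))

    topLeft-term : Fin (suc g) → Carrier
    topLeft-term j = sign A (toℕ j) (topLeft M zero j * det A g (minor (topLeft M) j))

    row≈0-at : ∀ {t} s → t ≡ inject₁ s → M (fromℕ (suc g)) t ≈ 0#
    row≈0-at s ≡.refl = row≈0 s

    term-last : term (fromℕ (suc g)) ≈ 0#
    term-last = begin
      term (fromℕ (suc g))                                       ≈⟨ sign-cong (toℕ (fromℕ (suc g))) (*-congˡ minor≈0) ⟩
      sign A (toℕ (fromℕ (suc g))) (M zero (fromℕ (suc g)) * 0#) ≈⟨ sign-cong (toℕ (fromℕ (suc g))) (zeroʳ _) ⟩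
      sign A (toℕ (fromℕ (suc g))) 0#                            ≈⟨ sign-0# (toℕ (fromℕ (suc g))) ⟩
      0#                                                         ∎
      where
      minor≈0 : det A (suc g) (minor M (fromℕ (suc g))) ≈ 0#
      minor≈0 = trans (det-lastRow g (minor M (fromℕ (suc g))) 0#
                        (λ s → row≈0-at (inject₁ s) (punchIn-fromℕ (inject₁ s)))
                        (row≈0-at (fromℕ g) (punchIn-fromℕ (fromℕ g))))
                      (zeroˡ _)

    term-inject₁ : ∀ j → term (inject₁ j) ≈ u * topLeft-term j
    term-inject₁ j = begin
      term (inject₁ j)
        ≡⟨ ≡.cong (λ k → sign A k (M zero (inject₁ j) * det A (suc g) (minor M (inject₁ j)))) (toℕ-inject₁ j) ⟩
      sign A (toℕ j) (topLeft M zero j * det A (suc g) (minor M (inject₁ j)))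
        ≈⟨ sign-cong (toℕ j) (*-congˡ (trans minor-expansion (*-congˡ (det-cong g topLeft-minor)))) ⟩
      sign A (toℕ j) (topLeft M zero j * (u * det A g (minor (topLeft M) j)))
        ≈⟨ sign-cong (toℕ j) (x*yz≈y*xz _ u _) ⟩
      sign A (toℕ j) (u * (topLeft M zero j * det A g (minor (topLeft M) j)))
        ≈⟨ *-sign (toℕ j) u _ ⟨
      u * topLeft-term j
        ∎
      where
      minor-expansion : det A (suc g) (minor M (inject₁ j)) ≈ u * det A g (topLeft (minor M (inject₁ j)))
      minor-expansion = det-lastRow g (minor M (inject₁ j)) u
        (λ s → row≈0-at (punchIn j s) (punchIn-inject₁ j s))
        (trans (reflexive (≡.cong (M (fromℕ (suc g))) (punchIn-inject₁-fromℕ j))) last≈u)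

      topLeft-minor : ∀ r s → topLeft (minor M (inject₁ j)) r s ≈ minor (topLeft M) j r s
      topLeft-minor r s = reflexive (≡.cong (M (suc (inject₁ r))) (punchIn-inject₁ j s))

linearFactor : ∀ {c ℓ} (A : RawRing c ℓ) → RawRing.Carrier A → List (RawRing.Carrier A)
linearFactor A u = RawRing.-_ A u ∷ RawRing.1# A ∷ []

module Degrees {c ℓ} (A : RawRing c ℓ) (isCommRing : IsCommutativeRawRing A) where

  open CommutativeRawRing A isCommRing
  open Polynomials A isCommRing
  open import Relation.Binary.Reasoning.Setoid setoid

  PA : RawRing c ℓ
  PA = PolyRing A

  open Polynomials PA PolyRing-isCommutativeRing using ()
    renaming (_*ₚ_ to _*ₚₚ_; 1ₚ to 1ₚₚ; coeff-∷-* to coeff-∷-*ₚₚ)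
  open Determinants PA PolyRing-isCommutativeRing using (minor)

  Degree≤ : ℕ → List Carrier → Set ℓ
  Degree≤ d xs = ∀ m → d < m → coeff A m xs ≈ 0#

  DegreeExactly : ℕ → List Carrier → Set ℓ
  DegreeExactly d xs = (¬ coeff A d xs ≈ 0#) × Degree≤ d xs

  DegreeExactly⇒≉0ₚ : ∀ {d} xs → DegreeExactly d xs → ¬ xs ≋ 0ₚ
  DegreeExactly⇒≉0ₚ {d} xs (top≉0 , _) xs≈0 = top≉0 (xs≈0 d)

  TopCoeff : ℕ → List Carrier → Carrier → Set ℓ
  TopCoeff d xs t = Degree≤ d xs × coeff A d xs ≈ t

  TopCoeff-resp-≋ : ∀ {d} xs ys {t} → xs ≋ ys → TopCoeff d xs t → TopCoeff d ys t
  TopCoeff-resp-≋ xs ys xs≋ys (deg , top) = (λ m d<m → trans (sym (xs≋ys m)) (deg m d<m)) , trans (sym (xs≋ys _)) top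

  TopCoeff-resp-≈ : ∀ {d} xs {t u} → t ≈ u → TopCoeff d xs t → TopCoeff d xs u
  TopCoeff-resp-≈ xs t≈u (deg , top) = deg , trans top t≈u

  TopCoeff-0ₚ : ∀ d → TopCoeff d 0ₚ 0#
  TopCoeff-0ₚ d = (λ _ _ → refl) , refl

  TopCoeff-const : ∀ x → TopCoeff 0 (x ∷ []) x
  TopCoeff-const x = (λ { (suc m) _ → refl }) , refl

  TopCoeff-linear : ∀ u v → TopCoeff 1 (u ∷ v ∷ []) v
  TopCoeff-linear u v = (λ { (suc zero) (s≤s ()) ; (suc (suc m)) _ → refl }) , refl

  TopCoeff-+ : ∀ {d} xs ys {s t} → TopCoeff d xs s → TopCoeff d ys t → TopCoeff d (xs +ₚ ys) (s + t)
  TopCoeff-+ xs ys (deg-xs , top-xs) (deg-ys , top-ys) =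
    (λ m d<m → trans (coeff-+ m xs ys) (trans (+-cong (deg-xs m d<m) (deg-ys m d<m)) (+-identityˡ 0#))) ,
    trans (coeff-+ _ xs ys) (+-cong top-xs top-ys)

  coeff-sign : ∀ k m xs → coeff A m (sign PA k xs) ≈ sign A k (coeff A m xs)
  coeff-sign zero          m xs = refl
  coeff-sign (suc zero)    m xs = coeff-neg m xs
  coeff-sign (suc (suc k)) m xs = coeff-sign k m xs

  TopCoeff-sign : ∀ k {d} xs {t} → TopCoeff d xs t → TopCoeff d (sign PA k xs) (sign A k t)
  TopCoeff-sign k xs (deg , top) =
    (λ m d<m → trans (coeff-sign k m xs) (trans (sign-cong k (deg m d<m)) (sign-0# k))) ,
    trans (coeff-sign k _ xs) (sign-cong k top)

  TopCoeff-* : ∀ a b xs ys {s t} → TopCoeff a xs s → TopCoeff b ys t → TopCoeff (a ℕ.+ b) (xs *ₚ ys) (s * t)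
  TopCoeff-* a b [] ys {t = t} (_ , 0≈s) _ = (λ _ _ → refl) , trans (sym (zeroˡ t)) (*-congʳ 0≈s)
  TopCoeff-* zero b (x ∷ xs) ys {s} {t} (deg-xs , x≈s) (deg-ys , top-ys) = deg , top
    where
    shifted≈0 : (0# ∷ xs *ₚ ys) ≋ 0ₚ
    shifted≈0 = 0∷-zero (xs *ₚ ys) (*ₚ-zeroˡ xs ys (λ m → deg-xs (suc m) (s≤s z≤n)))

    deg : Degree≤ b ((x ∷ xs) *ₚ ys)
    deg m b<m = begin
      coeff A m ((x ∷ xs) *ₚ ys)                   ≈⟨ coeff-∷-* m x xs ys ⟩
      x * coeff A m ys + coeff A m (0# ∷ xs *ₚ ys) ≈⟨ +-cong (trans (*-congˡ (deg-ys m b<m)) (zeroʳ x)) (shifted≈0 m) ⟩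
      0# + 0#                                      ≈⟨ +-identityˡ 0# ⟩
      0#                                           ∎

    top : coeff A b ((x ∷ xs) *ₚ ys) ≈ s * t
    top = begin
      coeff A b ((x ∷ xs) *ₚ ys)                   ≈⟨ coeff-∷-* b x xs ys ⟩
      x * coeff A b ys + coeff A b (0# ∷ xs *ₚ ys) ≈⟨ +-cong (*-cong x≈s top-ys) (shifted≈0 b) ⟩
      s * t + 0#                                   ≈⟨ +-identityʳ _ ⟩
      s * t                                        ∎
  TopCoeff-* (suc a) b (x ∷ xs) ys {s} {t} (deg-xs , top-xs) (deg-ys , top-ys) = deg , top
    where
    tail-top : TopCoeff (a ℕ.+ b) (xs *ₚ ys) (s * t)
    tail-top = TopCoeff-* a b xs ys ((λ m a<m → deg-xs (suc m) (s≤s a<m)) , top-xs) (deg-ys , top-ys)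

    head-term≈0 : ∀ m → a ℕ.+ b ≤ m → x * coeff A (suc m) ys ≈ 0#
    head-term≈0 m a+b≤m = trans (*-congˡ (deg-ys (suc m) (s≤s (ℕ.≤-trans (ℕ.m≤n+m b a) a+b≤m)))) (zeroʳ x)

    deg : Degree≤ (suc a ℕ.+ b) ((x ∷ xs) *ₚ ys)
    deg (suc m) (s≤s a+b<m) = begin
      coeff A (suc m) ((x ∷ xs) *ₚ ys)
        ≈⟨ coeff-∷-* (suc m) x xs ys ⟩
      x * coeff A (suc m) ys + coeff A m (xs *ₚ ys)
        ≈⟨ +-cong (head-term≈0 m (ℕ.<⇒≤ a+b<m)) (proj₁ tail-top m a+b<m) ⟩
      0# + 0#
        ≈⟨ +-identityˡ 0# ⟩
      0#
        ∎

    top : coeff A (suc a ℕ.+ b) ((x ∷ xs) *ₚ ys) ≈ s * t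
    top = begin
      coeff A (suc (a ℕ.+ b)) ((x ∷ xs) *ₚ ys)
        ≈⟨ coeff-∷-* (suc (a ℕ.+ b)) x xs ys ⟩
      x * coeff A (suc (a ℕ.+ b)) ys + coeff A (a ℕ.+ b) (xs *ₚ ys)
        ≈⟨ +-cong (head-term≈0 (a ℕ.+ b) ℕ.≤-refl) (proj₂ tail-top) ⟩
      0# + s * t
        ≈⟨ +-identityˡ _ ⟩
      s * t
        ∎

  TopCoeff-sumFin : ∀ n d (F : Fin n → List Carrier) {t : Fin n → Carrier} →
                    (∀ i → TopCoeff d (F i) (t i)) → TopCoeff d (sumFin PA n F) (sumFin A n t)
  TopCoeff-sumFin zero    d F F-top = TopCoeff-0ₚ d
  TopCoeff-sumFin (suc n) d F F-top = TopCoeff-+ (F zero) (sumFin PA n (λ i → F (suc i)))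
    (F-top zero) (TopCoeff-sumFin n d (λ i → F (suc i)) (λ i → F-top (suc i)))

  TopCoeff-det : ∀ g d (M : Fin g → Fin g → List Carrier) {N : Fin g → Fin g → Carrier} →
                 (∀ i j → TopCoeff d (M i j) (N i j)) → TopCoeff (g ℕ.* d) (det PA g M) (det A g N)
  TopCoeff-det zero    d M M-top = TopCoeff-const 1#
  TopCoeff-det (suc g) d M M-top = TopCoeff-sumFin (suc g) (suc g ℕ.* d) term λ j →
    TopCoeff-sign (toℕ j) (M zero j *ₚ det PA g (minor M j))
      (TopCoeff-* d (g ℕ.* d) (M zero j) (det PA g (minor M j))
        (M-top zero j) (TopCoeff-det g d (minor M j) (λ r s → M-top (suc r) (punchIn j s))))
    where
    term : Fin (suc g) → List Carrier
    term j = sign PA (toℕ j) (M zero j *ₚ det PA g (minor M j))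

  TopCoeff-prodFin : ∀ n d (F : Fin n → List Carrier) {t : Fin n → Carrier} →
                     (∀ i → TopCoeff d (F i) (t i)) → TopCoeff (n ℕ.* d) (prodFin PA n F) (prodFin A n t)
  TopCoeff-prodFin zero    d F F-top = TopCoeff-const 1#
  TopCoeff-prodFin (suc n) d F F-top = TopCoeff-* d (n ℕ.* d) (F zero) (prodFin PA n (λ i → F (suc i)))
    (F-top zero) (TopCoeff-prodFin n d (λ i → F (suc i)) (λ i → F-top (suc i)))

  TopCoeff-pow : ∀ n d xs {t} → TopCoeff d xs t → TopCoeff (n ℕ.* d) (pow PA xs n) (pow A t n)
  TopCoeff-pow zero    d xs xs-top = TopCoeff-const 1#
  TopCoeff-pow (suc n) d xs xs-top = TopCoeff-* d (n ℕ.* d) xs (pow PA xs n) xs-top (TopCoeff-pow n d xs xs-top)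

  PPA : RawRing c ℓ
  PPA = PolyRing PA

  -- P ∈ A[X][x] is a list in x of lists in X: each x-coefficient of P has X-degree ≤ d, and
  -- their X^d-coefficients are the coefficients of Q ∈ A[x].
  CoeffwiseTop : ℕ → List (List Carrier) → List Carrier → Set ℓ
  CoeffwiseTop d P Q = ∀ r → TopCoeff d (coeff PA r P) (coeff A r Q)

  CoeffwiseTop-cong : ∀ {d} P Q Q′ → Q ≋ Q′ → CoeffwiseTop d P Q → CoeffwiseTop d P Q′
  CoeffwiseTop-cong P Q Q′ Q≋Q′ P-top r = TopCoeff-resp-≈ (coeff PA r P) (Q≋Q′ r) (P-top r)

  CoeffwiseTop-1 : CoeffwiseTop 0 1ₚₚ 1ₚ
  CoeffwiseTop-1 zero    = TopCoeff-const 1#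
  CoeffwiseTop-1 (suc r) = TopCoeff-0ₚ 0

  head∷tail : ∀ xs → xs ≋ (coeff A 0 xs ∷ drop 1 xs)
  head∷tail []       zero    = refl
  head∷tail []       (suc i) = refl
  head∷tail (x ∷ xs) i       = refl

  CoeffwiseTop-* : ∀ a b P Q P′ Q′ → CoeffwiseTop a P P′ → CoeffwiseTop b Q Q′ →
                   CoeffwiseTop (a ℕ.+ b) (P *ₚₚ Q) (P′ *ₚ Q′)
  CoeffwiseTop-* a b []      Q P′ Q′ P-top Q-top r =
    TopCoeff-resp-≈ [] (sym (*ₚ-zeroˡ P′ Q′ (λ i → sym (proj₂ (P-top i))) r)) (TopCoeff-0ₚ (a ℕ.+ b))
  CoeffwiseTop-* a b (p ∷ P) Q P′ Q′ P-top Q-top r =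
    TopCoeff-resp-≋ expansion (coeff PA r ((p ∷ P) *ₚₚ Q)) (λ i → sym (coeff-∷-*ₚₚ r p P Q i))
      (TopCoeff-resp-≈ expansion (sym product-expansion)
        (TopCoeff-+ (p *ₚ coeff PA r Q) (coeff PA r ([] ∷ P *ₚₚ Q))
          (TopCoeff-* a b p (coeff PA r Q) (P-top 0) (Q-top r)) (shifted-top r)))
    where
    expansion : List Carrier
    expansion = p *ₚ coeff PA r Q +ₚ coeff PA r ([] ∷ P *ₚₚ Q)

    tail-top : CoeffwiseTop (a ℕ.+ b) (P *ₚₚ Q) (drop 1 P′ *ₚ Q′)
    tail-top = CoeffwiseTop-* a b P Q (drop 1 P′) Q′
      (λ r → TopCoeff-resp-≈ (coeff PA r P) (head∷tail P′ (suc r)) (P-top (suc r))) Q-top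

    shifted-top : ∀ r → TopCoeff (a ℕ.+ b) (coeff PA r ([] ∷ P *ₚₚ Q)) (coeff A r (0# ∷ drop 1 P′ *ₚ Q′))
    shifted-top zero    = TopCoeff-0ₚ (a ℕ.+ b)
    shifted-top (suc r) = tail-top r

    product-expansion : coeff A r (P′ *ₚ Q′) ≈ coeff A 0 P′ * coeff A r Q′ + coeff A r (0# ∷ drop 1 P′ *ₚ Q′)
    product-expansion = trans (*ₚ-congʳ P′ (coeff A 0 P′ ∷ drop 1 P′) Q′ (head∷tail P′) r)
                              (coeff-∷-* r (coeff A 0 P′) (drop 1 P′) Q′)

  CoeffwiseTop-pow : ∀ n d P Q → CoeffwiseTop d P Q → CoeffwiseTop (n ℕ.* d) (pow PPA P n) (pow PA Q n)
  CoeffwiseTop-pow zero    d P Q P-top = CoeffwiseTop-1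
  CoeffwiseTop-pow (suc n) d P Q P-top =
    CoeffwiseTop-* d (n ℕ.* d) P (pow PPA P n) Q (pow PA Q n) P-top (CoeffwiseTop-pow n d P Q P-top)

  CoeffwiseTop-prodFin-last : ∀ m d (H : Fin (suc m) → List (List Carrier)) (G : Fin m → List Carrier) Q →
    (∀ i → CoeffwiseTop 0 (H (inject₁ i)) (G i)) → CoeffwiseTop d (H (fromℕ m)) Q →
    CoeffwiseTop d (prodFin PPA (suc m) H) (prodFin PA m G *ₚ Q)
  CoeffwiseTop-prodFin-last zero    d H G Q init-top last-top =
    CoeffwiseTop-cong (H zero *ₚₚ 1ₚₚ) (Q *ₚ 1ₚ) (1ₚ *ₚ Q) (*ₚ-comm Q 1ₚ)
      (≡.subst (λ e → CoeffwiseTop e (H zero *ₚₚ 1ₚₚ) (Q *ₚ 1ₚ)) (ℕ.+-identityʳ d)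
        (CoeffwiseTop-* d 0 (H zero) 1ₚₚ Q 1ₚ last-top CoeffwiseTop-1))
  CoeffwiseTop-prodFin-last (suc m) d H G Q init-top last-top =
    CoeffwiseTop-cong (H zero *ₚₚ prodFin PPA (suc m) (λ i → H (suc i))) (G zero *ₚ (G′ *ₚ Q)) ((G zero *ₚ G′) *ₚ Q)
      (≋-sym ((G zero *ₚ G′) *ₚ Q) (G zero *ₚ (G′ *ₚ Q)) (*ₚ-assoc (G zero) G′ Q))
      (CoeffwiseTop-* 0 d (H zero) (prodFin PPA (suc m) (λ i → H (suc i))) (G zero) (G′ *ₚ Q) (init-top zero)
        (CoeffwiseTop-prodFin-last m d (λ i → H (suc i)) (λ i → G (suc i)) Q (λ i → init-top (suc i)) last-top))
    where
    G′ : List Carrier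
    G′ = prodFin PA m (λ i → G (suc i))

  TopCoeff-prodFin-linearFactor : ∀ m (u : Fin m → Carrier) → TopCoeff m (prodFin PA m (λ i → linearFactor A (u i))) 1#
  TopCoeff-prodFin-linearFactor m u = TopCoeff-resp-≈ F (prodFin-1# m)
    (≡.subst (λ d → TopCoeff d F (prodFin A m (λ _ → 1#))) (ℕ.*-identityʳ m)
      (TopCoeff-prodFin m 1 (λ i → linearFactor A (u i)) (λ i → TopCoeff-linear (- u i) 1#)))
    where
    F : List Carrier
    F = prodFin PA m (λ i → linearFactor A (u i))

  X : List Carrier
  X = 0# ∷ 1# ∷ []

  CoeffwiseTop-linearFactor-const : ∀ u → CoeffwiseTop 0 (linearFactor PA (u ∷ [])) (linearFactor A u)
  CoeffwiseTop-linearFactor-const u zero          = TopCoeff-const (- u)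
  CoeffwiseTop-linearFactor-const u (suc zero)    = TopCoeff-const 1#
  CoeffwiseTop-linearFactor-const u (suc (suc r)) = TopCoeff-0ₚ 0

  CoeffwiseTop-linearFactor-X : CoeffwiseTop 1 (linearFactor PA X) (-ₚ 1ₚ)
  CoeffwiseTop-linearFactor-X zero          = TopCoeff-linear (- 0#) (- 1#)
  CoeffwiseTop-linearFactor-X (suc zero)    = (λ { (suc zero) (s≤s ()) ; (suc (suc m)) _ → refl }) , refl
  CoeffwiseTop-linearFactor-X (suc (suc r)) = TopCoeff-0ₚ 1

  CoeffwiseTop-prodFin-linearFactor : ∀ m (u : Fin m → Carrier) (r : Fin (suc m) → List Carrier) →
    (∀ i → r (inject₁ i) ≡ u i ∷ []) → r (fromℕ m) ≡ X →
    CoeffwiseTop 1 (prodFin PPA (suc m) (λ i → linearFactor PA (r i))) (-ₚ prodFin PA m (λ i → linearFactor A (u i)))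
  CoeffwiseTop-prodFin-linearFactor m u r r-const r-last =
    CoeffwiseTop-cong (prodFin PPA (suc m) (λ i → linearFactor PA (r i))) (G *ₚ -ₚ 1ₚ) (-ₚ G) (*ₚ-1ₚ G)
      (CoeffwiseTop-prodFin-last m 1 (λ i → linearFactor PA (r i)) (λ i → linearFactor A (u i)) (-ₚ 1ₚ)
        (λ i → ≡.subst (λ v → CoeffwiseTop 0 (linearFactor PA v) (linearFactor A (u i))) (≡.sym (r-const i))
                 (CoeffwiseTop-linearFactor-const (u i)))
        (≡.subst (λ v → CoeffwiseTop 1 (linearFactor PA v) (-ₚ 1ₚ)) (≡.sym r-last) CoeffwiseTop-linearFactor-X))
    where
    G : List Carrier
    G = prodFin PA m (λ i → linearFactor A (u i))

<ᵇ≡false : ∀ m n → n ≤ m → (m ℕ.<ᵇ n) ≡ false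
<ᵇ≡false m n n≤m with m ℕ.<ᵇ n | ℕ.<ᵇ⇒< m n
... | false | _   = ≡.refl
... | true  | m<n = ⊥-elim (ℕ.<⇒≱ (m<n _) n≤m)

lastRow-index : ∀ n g t → t ≤ g →
                suc g ℕ.* suc (n ℕ.+ n) ℕ.∸ suc t ≡ n ℕ.* suc (suc (2 ℕ.* g)) ℕ.+ (g ℕ.∸ t)
lastRow-index n g t t≤g =
  ≡.trans (≡.cong (ℕ._∸ suc t) product) (ℕ.+-∸-assoc (n ℕ.* suc (suc (2 ℕ.* g))) (s≤s t≤g))
  where
  open +-*-Solver
  product : suc g ℕ.* suc (n ℕ.+ n) ≡ n ℕ.* suc (suc (2 ℕ.* g)) ℕ.+ suc g
  product = solve 2 (λ g n → (con 1 :+ g) :* (con 1 :+ (n :+ n)) := n :* (con 2 :+ con 2 :* g) :+ (con 1 :+ g)) ≡.refl g n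

odd-prime : ∀ p → Prime p → 2 < p → p ≡ suc ((p ℕ.∸ 1) ℕ./ 2 ℕ.+ (p ℕ.∸ 1) ℕ./ 2)
odd-prime (suc q) p-prime 2<p with q ℕ.% 2 | ℕ.m%n<n q 2 | ℕ.m≡m%n+[m/n]*n q 2
... | zero        | _             | q≡2[q/2]   =
  ≡.cong suc (≡.trans q≡2[q/2] (≡.trans (ℕ.*-comm (q ℕ./ 2) 2)
                                        (≡.cong (q ℕ./ 2 ℕ.+_) (ℕ.+-identityʳ (q ℕ./ 2)))))
... | suc zero    | _             | q≡1+2[q/2] =
  ⊥-elim (Prime.notComposite p-prime (composite 2<p (divides (suc (q ℕ./ 2)) (≡.cong suc q≡1+2[q/2]))))
... | suc (suc _) | s≤s (s≤s ()) | _

module HasseWitt (p : ℕ) where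

  n : ℕ
  n = (p ℕ.∸ 1) ℕ./ 2

  module _ {c ℓ} (A : RawRing c ℓ) where

    -- With 0-based i, j: the coefficient c_{(i+1)p−(j+1)} of hⁿ, and 0 if that index is negative.
    entry : List (RawRing.Carrier A) → ℕ → ℕ → RawRing.Carrier A
    entry h i j = if suc i ℕ.* p ℕ.<ᵇ suc j
                  then RawRing.0# A
                  else coeff A (suc i ℕ.* p ℕ.∸ suc j) (pow (PolyRing A) h n)

    hasseDet : List (RawRing.Carrier A) → ℕ → RawRing.Carrier A
    hasseDet h g = det A g (λ i j → entry h (toℕ i) (toℕ j))

  module Properties {c ℓ} (A : RawRing c ℓ) (isCommRing : IsCommutativeRawRing A) where

    open CommutativeRawRing A isCommRing
    open Polynomials A isCommRing
    open Determinants A isCommRing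
    open Degrees A isCommRing
    open import Relation.Binary.Reasoning.Setoid setoid

    pow-top : ∀ P Q → CoeffwiseTop 1 P (-ₚ Q) → CoeffwiseTop n (pow PPA P n) (sign PA n (pow PA Q n))
    pow-top P Q P-top =
      CoeffwiseTop-cong (pow PPA P n) (pow PA (-ₚ Q) n) (sign PA n (pow PA Q n))
        (CommutativeRawRing.pow-neg PA PolyRing-isCommutativeRing n Q)
        (≡.subst (λ d → CoeffwiseTop d (pow PPA P n) (pow PA (-ₚ Q) n)) (ℕ.*-identityʳ n)
          (CoeffwiseTop-pow n 1 P (-ₚ Q) P-top))

    entry-top : ∀ P Q → CoeffwiseTop 1 P (-ₚ Q) → ∀ i j → TopCoeff n (entry PA P i j) (sign A n (entry A Q i j))
    entry-top P Q P-top i j = truncated (suc i ℕ.* p ℕ.<ᵇ suc j) (suc i ℕ.* p ℕ.∸ suc j)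
      where
      truncated : ∀ b r → TopCoeff n (if b then 0ₚ else coeff PA r (pow PPA P n))
                                     (sign A n (if b then 0# else coeff A r (pow PA Q n)))
      truncated true  r = TopCoeff-resp-≈ 0ₚ (sym (sign-0# n)) (TopCoeff-0ₚ n)
      truncated false r = TopCoeff-resp-≈ (coeff PA r (pow PPA P n)) (coeff-sign n r (pow PA Q n)) (pow-top P Q P-top r)

    hasseDet-degree : ∀ g P Q → CoeffwiseTop 1 P (-ₚ Q) → ¬ hasseDet A Q g ≈ 0# →
                      DegreeExactly (g ℕ.* n) (hasseDet PA P g)
    hasseDet-degree g P Q P-top Q≉0 =
      (λ top≈0 → Q≉0 (det-sign≈0⇒det≈0 g n _ (trans (sym (proj₂ det-top)) top≈0))) , proj₁ det-top
      where
      det-top : TopCoeff (g ℕ.* n) (hasseDet PA P g) (det A g (λ i j → sign A n (entry A Q (toℕ i) (toℕ j))))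
      det-top = TopCoeff-det g n _ (λ i j → entry-top P Q P-top (toℕ i) (toℕ j))

    hasseDet-lastRow≉0 : p ≡ suc (n ℕ.+ n) → ∀ g Q → TopCoeff (suc (suc (2 ℕ.* g))) Q 1# →
                         ¬ hasseDet A Q g ≈ 0# → ¬ hasseDet A Q (suc g) ≈ 0#
    hasseDet-lastRow≉0 p≡2n+1 g Q Q-monic Q≉0 Q≈0 = Q≉0 (trans (sym hasseDet-lastRow) Q≈0)
      where
      N : ℕ
      N = suc (suc (2 ℕ.* g))

      M : Matrix (suc g)
      M i j = entry A Q (toℕ i) (toℕ j)

      Qⁿ-top : TopCoeff (n ℕ.* N) (pow PA Q n) 1#
      Qⁿ-top = TopCoeff-resp-≈ (pow PA Q n) (pow-1# n) (TopCoeff-pow n N Q Q-monic)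

      lastRow-entry : ∀ t → t ≤ g → entry A Q g t ≡ coeff A (n ℕ.* N ℕ.+ (g ℕ.∸ t)) (pow PA Q n)
      lastRow-entry t t≤g
        rewrite <ᵇ≡false (suc g ℕ.* p) (suc t)
                  (≡.subst (λ q → suc t ≤ suc g ℕ.* q) (≡.sym p≡2n+1)
                    (ℕ.≤-trans (s≤s t≤g) (ℕ.m≤m*n (suc g) (suc (n ℕ.+ n)))))
              | ≡.trans (≡.cong (λ q → suc g ℕ.* q ℕ.∸ suc t) p≡2n+1) (lastRow-index n g t t≤g)
              = ≡.refl

      row≈0 : ∀ j → M (fromℕ g) (inject₁ j) ≈ 0#
      row≈0 j rewrite toℕ-fromℕ g | toℕ-inject₁ j = begin
        entry A Q g (toℕ j)
          ≡⟨ lastRow-entry (toℕ j) (ℕ.<⇒≤ (toℕ<n j)) ⟩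
        coeff A (n ℕ.* N ℕ.+ (g ℕ.∸ toℕ j)) (pow PA Q n)
          ≈⟨ proj₁ Qⁿ-top _ (ℕ.m<m+n (n ℕ.* N) (ℕ.m<n⇒0<n∸m (toℕ<n j))) ⟩
        0#
          ∎

      last≈1 : M (fromℕ g) (fromℕ g) ≈ 1#
      last≈1 rewrite toℕ-fromℕ g = begin
        entry A Q g g
          ≡⟨ lastRow-entry g ℕ.≤-refl ⟩
        coeff A (n ℕ.* N ℕ.+ (g ℕ.∸ g)) (pow PA Q n)
          ≡⟨ ≡.cong (λ i → coeff A i (pow PA Q n)) (≡.trans (≡.cong (n ℕ.* N ℕ.+_) (ℕ.n∸n≡0 g)) (ℕ.+-identityʳ _)) ⟩
        coeff A (n ℕ.* N) (pow PA Q n)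
          ≈⟨ proj₂ Qⁿ-top ⟩
        1#
          ∎

      hasseDet-lastRow : hasseDet A Q (suc g) ≈ hasseDet A Q g
      hasseDet-lastRow = begin
        det A (suc g) M
          ≈⟨ det-lastRow g M 1# row≈0 last≈1 ⟩
        1# * det A g (topLeft M)
          ≈⟨ *-identityˡ _ ⟩
        det A g (topLeft M)
          ≈⟨ det-cong g (λ i j → reflexive (≡.cong₂ (entry A Q) (toℕ-inject₁ i) (toℕ-inject₁ j))) ⟩
        hasseDet A Q g
          ∎

opposite-inject₁ : ∀ {n} (i : Fin n) → opposite (inject₁ i) ≡ suc (opposite i)
opposite-inject₁ {suc n} zero    = ≡.refl
opposite-inject₁ {suc n} (suc i) = ≡.cong inject₁ (opposite-inject₁ i)

opposite-fromℕ : ∀ n → opposite (fromℕ n) ≡ zero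
opposite-fromℕ zero    = ≡.refl
opposite-fromℕ (suc n) = ≡.cong inject₁ (opposite-fromℕ n)

module GenericCurve {a ℓ} (K : CommutativeRing a ℓ) (p : ℕ) where

  open CommutativeRing K using (rawRing)
  open HasseWitt p

  Λ : ℕ → RawRing a ℓ
  Λ k = MPoly rawRing (suc k)

  Λ-isCommutativeRing : ∀ k → IsCommutativeRawRing (Λ k)
  Λ-isCommutativeRing k = MPoly-isCommutativeRing K (suc k)

  -- The roots λᵢ₊₁ = var (opposite i) of f k: the last one is the outermost variable of Λ k,
  -- so Det k g is D(k+1, g).
  roots : ∀ k → Fin (suc k) → RawRing.Carrier (Λ k)
  roots k i = var rawRing (suc k) (opposite i)

  f : ∀ k → List (RawRing.Carrier (Λ k))
  f k = prodFin (PolyRing (Λ k)) (suc k) (λ i → linearFactor (Λ k) (roots k i))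

  Det : ∀ k g → RawRing.Carrier (Λ k)
  Det k g = hasseDet (Λ k) (f k) g

  DetNonZero : ℕ → ℕ → Set ℓ
  DetNonZero k g = ¬ RawRing._≈_ (Λ k) (Det k g) (RawRing.0# (Λ k))

  module _ (k : ℕ) where

    open Polynomials (Λ k) (Λ-isCommutativeRing k) using (-ₚ_)
    open Degrees (Λ k) (Λ-isCommutativeRing k)
    open Properties (Λ k) (Λ-isCommutativeRing k)

    f-top : CoeffwiseTop 1 (f (suc k)) (-ₚ f k)
    f-top = CoeffwiseTop-prodFin-linearFactor (suc k) (roots k) (roots (suc k))
      (λ i → ≡.cong (var rawRing (suc (suc k))) (opposite-inject₁ i))
      (≡.cong (var rawRing (suc (suc k))) (opposite-fromℕ (suc k)))

    f-monic : TopCoeff (suc k) (f k) (RawRing.1# (Λ k))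
    f-monic = TopCoeff-prodFin-linearFactor (suc k) (roots k)

    Det-degree : ∀ g → DetNonZero k g → DegreeExactly (g ℕ.* n) (Det (suc k) g)
    Det-degree g = hasseDet-degree g (f (suc k)) (f k) f-top

    DetNonZero-suc : ∀ g → DetNonZero k g → DetNonZero (suc k) g
    DetNonZero-suc g Det≉0 = DegreeExactly⇒≉0ₚ (Det (suc k) g) (Det-degree g Det≉0)

  module _ (1≉0 : ¬ CommutativeRing._≈_ K (CommutativeRing.1# K) (CommutativeRing.0# K))
           (p≡2n+1 : p ≡ suc (n ℕ.+ n)) where

    Det-odd≉0  : ∀ g → DetNonZero (2 ℕ.* g) g
    Det-even≉0 : ∀ g → DetNonZero (suc (2 ℕ.* g)) (suc g)

    Det-odd≉0 zero    Det≈0 = 1≉0 (Det≈0 0)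
    Det-odd≉0 (suc g) = ≡.subst (λ k → DetNonZero k (suc g)) (≡.sym (ℕ.*-suc 2 g))
      (DetNonZero-suc (suc (2 ℕ.* g)) (suc g) (Det-even≉0 g))

    Det-even≉0 g = hasseDet-lastRow≉0 (Λ (suc (2 ℕ.* g))) (Λ-isCommutativeRing (suc (2 ℕ.* g))) p≡2n+1 g
      (f (suc (2 ℕ.* g))) (f-monic (suc (2 ℕ.* g))) (DetNonZero-suc (2 ℕ.* g) g (Det-odd≉0 g))
      where open Properties

open import Data.Nat using (_*_; _∸_; _/_)

lemma4p2 : ∀ {c ℓ} (K : CommutativeRing c ℓ) → IsField K →
    (p : ℕ) → HasCharacteristic K p → 2 < p →
    (g : ℕ) → 1 ≤ g →
    Hasse.DegreeInLastIs K p g (g * ((p ∸ 1) / 2))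
lemma4p2 K (1≉0 , _) p (p-prime , _) 2<p (suc g) _ =
  ≡.subst (λ k → Degrees.DegreeExactly (MPoly (CommutativeRing.rawRing K) k) (MPoly-isCommutativeRing K k)
                   (suc g * HasseWitt.n p) (Det k (suc g)))
    (≡.sym (ℕ.*-suc 2 g))
    (Det-degree (suc (2 * g)) (suc g) (Det-even≉0 1≉0 (odd-prime p p-prime 2<p) g))
  where open GenericCurve K p
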